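{- Let $\mathcal{A}$ be a finite, separating, union-closed collection of sets which is a counterexample to the union-closed sets conjecture and which has minimal cardinality among all counterexamples (i.e., every finite union-closed collection with fewer sets than $\mathcal{A}$ that contains a non-empty set has an element belonging to at least half of its sets). Then $|\mathcal{A}|\ge 4m-1$, where $m=|U(\mathcal{A})|$.
   Context: A collection $\mathcal{A}$ is union-closed if $S,T\in\mathcal{A}$ implies $S\cup T\in\mathcal{A}$. The universe $U(\mathcal{A})=\bigcup_{A\in\mathcal{A}}A$. $\mathcal{A}$ is separating if for any two distinct elements of $U(\mathcal{A})$ there is a set in $\mathcal{A}$ containing one of them but not the other. A counterexample to the union-closed sets conjecture is a finite union-closed collection of sets containing at least one non-empty set such that every element of $U(\mathcal{A})$ belongs to fewer than $|\mathcal{A}|/2$ of the sets of $\mathcal{A}$. -}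

module Defs where

open import Data.Nat using (ℕ; _*_; _<_; _≤_; _≥_)
open import Data.Fin using (Fin)
open import Data.Fin.Subset using (Subset; _∪_; ⋃; ∣_∣; Nonempty; _∉_) renaming (_∈_ to _∈ˢ_)
open import Data.Fin.Subset.Properties using (_∈?_)
open import Data.List using (List; length; filter)
open import Data.List.Membership.Propositional using (_∈_)
open import Data.List.Relation.Unary.Unique.Propositional using (Unique)
open import Data.Product using (Σ; ∃; _×_; _,_)
open import Data.Sum using (_⊎_)
open import Relation.Nullary using (¬_)
open import Relation.Binary.PropositionalEquality using (_≡_)

record Collection (n : ℕ) : Set where
  constructor mkCollection
  field
    sets   : List (Subset n)
    unique : Unique sets
open Collection public

size : ∀ {n} → Collection n → ℕ
size 𝒜 = length (sets 𝒜)

U : ∀ {n} → Collection n → Subset n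
U 𝒜 = ⋃ (sets 𝒜)

freq : ∀ {n} → Collection n → Fin n → ℕ
freq 𝒜 x = length (filter (λ S → x ∈? S) (sets 𝒜))

UnionClosed : ∀ {n} → Collection n → Set
UnionClosed 𝒜 = ∀ {S T} → S ∈ sets 𝒜 → T ∈ sets 𝒜 → (S ∪ T) ∈ sets 𝒜

Separating : ∀ {n} → Collection n → Set
Separating 𝒜 = ∀ x y → x ∈ˢ U 𝒜 → y ∈ˢ U 𝒜 → ¬ (x ≡ y) →
  Σ (Subset _) λ S → S ∈ sets 𝒜 × ((x ∈ˢ S × y ∉ S) ⊎ (y ∈ˢ S × x ∉ S))

HasNonemptySet : ∀ {n} → Collection n → Set
HasNonemptySet 𝒜 = Σ (Subset _) λ S → S ∈ sets 𝒜 × Nonempty S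

Counterexample : ∀ {n} → Collection n → Set
Counterexample 𝒜 = UnionClosed 𝒜 × HasNonemptySet 𝒜 ×
  (∀ x → x ∈ˢ U 𝒜 → 2 * freq 𝒜 x < size 𝒜)

MinimalCounterexample : ∀ {n} → Collection n → Set
MinimalCounterexample 𝒜 = Counterexample 𝒜 ×
  (∀ n′ (ℬ : Collection n′) → size ℬ < size 𝒜 → UnionClosed ℬ → HasNonemptySet ℬ →
     ∃ λ x → x ∈ˢ U ℬ × 2 * freq ℬ x ≥ size ℬ)

module Submission where

-- For x ∈ U(𝒜) let M x (maxAvoiding x) be the union of the members of 𝒜 avoiding x. In a
-- counterexample every x is avoided by some member, so M x ∈ 𝒜, and separation turns the
-- M x into a tournament: for x ≠ y, y ∈ M x or x ∈ M y. Hence an element x minimising |M x|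
-- lies in M z for every other z, and the same holds for an element y minimising |M y| among
-- those that are abundant in the family ℬ of members avoiding x, since abundance in ℬ passes
-- upwards along the tournament; such elements exist by minimality of 𝒜, as ℬ is smaller.
-- Now U together with the sets M z, z ∉ {x, y}, are m − 1 distinct members containing both
-- x and y, so m − 1 ≤ c, the number of such members, while the rarity of x and y in 𝒜 and
-- the abundance of y in ℬ give 4c + 3 ≤ |𝒜|.

open import Defs
open import Data.Fin using (Fin; zero; suc; _≟_)
import Data.Fin as Fin
open import Data.Fin.Properties using (any?; suc-injective)
open import Data.Fin.Subset using (Subset; inside; outside; ⋃; ∣_∣; ⊥; _⊆_; _⊂_)
  renaming (_∈_ to _∈ˢ_; _∉_ to _∉ˢ_)
open import Data.Fin.Subset.Properties
  using (_∈?_; x∈p∪q⁻; p⊆p∪q; q⊆p∪q; ∉⊥; ∪-identityʳ; p⊂q⇒∣p∣<∣q∣; nonempty?; Empty-unique)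
open import Data.List using (List; []; _∷_; [_]; length; filter; map)
open import Data.List.Properties using (length-map; length-removeAt′; filter-some)
open import Data.List.Membership.Propositional using (_∈_; _∉_; find; lose)
open import Data.List.Membership.Propositional.Properties using (∈-filter⁺; ∈-filter⁻; ∈-map⁻)
import Data.List.Relation.Unary.All as All
open import Data.List.Relation.Unary.AllPairs using ([]; _∷_)
open import Data.List.Relation.Unary.Any using (here; there; index; _─_)
import Data.List.Relation.Unary.Any as Any
open import Data.List.Relation.Unary.Unique.Propositional using (Unique)
import Data.List.Relation.Unary.Unique.Propositional.Properties as Unique
open import Data.Nat using (ℕ; suc; _+_; _*_; _≤_; _<_; _≥_; z≤n; s≤s; _<?_; _≤?_)
open import Data.Nat.Induction using (<-wellFounded)
open import Data.Nat.Properties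
  using (+-suc; m≤n⇒m≤1+n; ≮⇒≥; <⇒≱; ≤⇒≯; ≤-trans; m≤m+n; +-monoˡ-≤; +-monoʳ-≤; *-monoʳ-≤;
         +-cancelʳ-<; *-distribˡ-+; module ≤-Reasoning)
open import Data.Nat.Tactic.RingSolver using (solve-∀)
open import Data.Product using (∃; _×_; _,_; proj₁; proj₂)
open import Data.Sum using (_⊎_; inj₁; inj₂; [_,_]′)
open import Data.Vec using ([]; _∷_; here; there)
open import Function using (_∘_; id)
open import Induction.WellFounded using (Acc; acc)
open import Level using (Level)
open import Relation.Binary.PropositionalEquality using (_≡_; _≢_; refl; sym; trans; cong; subst)
open import Relation.Nullary using (yes; no)
open import Relation.Nullary.Decidable using (_×-dec_; decidable-stable)
open import Relation.Nullary.Negation using (contradiction)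
open import Relation.Unary using (Pred; Decidable)
open import Relation.Unary.Properties using (∁?)

private variable
  a p q : Level
  A B : Set a
  n : ℕ

module _ {P : Pred A p} (P? : Decidable P) where

  length-filter-∁ : ∀ xs → length xs ≡ length (filter P? xs) + length (filter (∁? P?) xs)
  length-filter-∁ [] = refl
  length-filter-∁ (x ∷ xs) with P? x
  ... | yes _ = cong suc (length-filter-∁ xs)
  ... | no _  = trans (cong suc (length-filter-∁ xs)) (sym (+-suc _ _))

module _ {P : Pred A p} {Q : Pred A q} (P? : Decidable P) (Q? : Decidable Q) where

  length-filter-split : ∀ xs → length (filter P? xs) ≡
    length (filter P? (filter Q? xs)) + length (filter P? (filter (∁? Q?) xs))
  length-filter-split [] = refl
  length-filter-split (x ∷ xs) with Q? x
  ... | yes _ with P? x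
  ...   | yes _ = cong suc (length-filter-split xs)
  ...   | no _  = length-filter-split xs
  length-filter-split (x ∷ xs) | no _ with P? x
  ...   | yes _ = trans (cong suc (length-filter-split xs)) (sym (+-suc _ _))
  ...   | no _  = length-filter-split xs

  length-filter-mono : ∀ xs → (∀ {x} → x ∈ xs → P x → Q x) →
    length (filter P? xs) ≤ length (filter Q? xs)
  length-filter-mono [] _ = z≤n
  length-filter-mono (x ∷ xs) P⇒Q with P? x | Q? x
  ... | yes _  | yes _ = s≤s (length-filter-mono xs (P⇒Q ∘ there))
  ... | yes px | no ¬qx = contradiction (P⇒Q (here refl) px) ¬qx
  ... | no _   | yes _ = m≤n⇒m≤1+n (length-filter-mono xs (P⇒Q ∘ there))
  ... | no _   | no _  = length-filter-mono xs (P⇒Q ∘ there)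

∈-─ : ∀ {x y : A} {ys} (x∈ys : x ∈ ys) → y ∈ ys → y ≢ x → y ∈ (ys ─ x∈ys)
∈-─ (here refl) (here refl) y≢x = contradiction refl y≢x
∈-─ (here refl) (there y∈ys) _  = y∈ys
∈-─ (there x∈ys) (here refl) _  = here refl
∈-─ (there x∈ys) (there y∈ys) y≢x = there (∈-─ x∈ys y∈ys y≢x)

length-≤-injection : ∀ {xs : List A} {ys : List B} {f : A → B} → Unique xs →
  (∀ {u v} → u ∈ xs → v ∈ xs → f u ≡ f v → u ≡ v) →
  (∀ {u} → u ∈ xs → f u ∈ ys) → length xs ≤ length ys
length-≤-injection {xs = []} _ _ _ = z≤n
length-≤-injection {xs = x ∷ xs} {ys} {f} (x∉xs ∷ xs!) injective into = begin
  suc (length xs)            ≤⟨ s≤s (length-≤-injection xs! injective′ into′) ⟩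
  suc (length (ys ─ fx∈ys))  ≡⟨ sym (length-removeAt′ ys (index fx∈ys)) ⟩
  length ys                  ∎
  where
  open ≤-Reasoning
  fx∈ys : f x ∈ ys
  fx∈ys = into (here refl)
  injective′ : ∀ {u v} → u ∈ xs → v ∈ xs → f u ≡ f v → u ≡ v
  injective′ u∈ v∈ = injective (there u∈) (there v∈)
  into′ : ∀ {u} → u ∈ xs → f u ∈ (ys ─ fx∈ys)
  into′ u∈xs = ∈-─ fx∈ys (into (there u∈xs)) λ fu≡fx →
    All.lookup x∉xs u∈xs (sym (injective (there u∈xs) (here refl) fu≡fx))

∃-minimal : ∀ {P : Pred (Fin n) p} → Decidable P → (f : Fin n → ℕ) → ∀ {x} → P x →
  ∃ λ y → P y × (∀ z → P z → f y ≤ f z)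
∃-minimal {P = P} P? f {x} px = go x px (<-wellFounded (f x))
  where
  go : ∀ x → P x → Acc _<_ (f x) → ∃ λ y → P y × (∀ z → P z → f y ≤ f z)
  go x px (acc smaller) with any? (λ z → P? z ×-dec f z <? f x)
  ... | yes (z , pz , fz<fx) = go z pz (smaller fz<fx)
  ... | no ∄smaller = x , px , λ z pz → ≮⇒≥ λ fz<fx → ∄smaller (z , pz , fz<fx)

elements : Subset n → List (Fin n)
elements []            = []
elements (inside ∷ p)  = zero ∷ map suc (elements p)
elements (outside ∷ p) = map suc (elements p)

length-elements : (p : Subset n) → length (elements p) ≡ ∣ p ∣
length-elements []            = refl
length-elements (inside ∷ p)  = cong suc (trans (length-map suc (elements p)) (length-elements p))
length-elements (outside ∷ p) = trans (length-map suc (elements p)) (length-elements p)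

∈-elements⁻ : (p : Subset n) {x : Fin n} → x ∈ elements p → x ∈ˢ p
∈-elements⁻ (inside ∷ p) (here refl) = here
∈-elements⁻ (inside ∷ p) (there x∈) with ∈-map⁻ suc x∈
... | _ , y∈ , refl = there (∈-elements⁻ p y∈)
∈-elements⁻ (outside ∷ p) x∈ with ∈-map⁻ suc x∈
... | _ , y∈ , refl = there (∈-elements⁻ p y∈)

zero∉map-suc : ∀ {xs : List (Fin n)} → zero ∉ map suc xs
zero∉map-suc 0∈ with ∈-map⁻ Fin.suc 0∈
... | _ , _ , ()

elements-Unique : (p : Subset n) → Unique (elements p)
elements-Unique []            = []
elements-Unique (inside ∷ p)  =
  All.tabulate (λ x∈ 0≡x → zero∉map-suc (subst (_∈ _) (sym 0≡x) x∈))
  ∷ Unique.map⁺ suc-injective (elements-Unique p)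
elements-Unique (outside ∷ p) = Unique.map⁺ suc-injective (elements-Unique p)

x∈⋃⁻ : ∀ {x : Fin n} (L : List (Subset n)) → x ∈ˢ ⋃ L → ∃ λ S → S ∈ L × x ∈ˢ S
x∈⋃⁻ []      x∈ = contradiction x∈ ∉⊥
x∈⋃⁻ (S ∷ L) x∈ with x∈p∪q⁻ S (⋃ L) x∈
... | inj₁ x∈S = S , here refl , x∈S
... | inj₂ x∈⋃L with x∈⋃⁻ L x∈⋃L
...   | T , T∈L , x∈T = T , there T∈L , x∈T

∈⇒⊆⋃ : ∀ {S : Subset n} {L} → S ∈ L → S ⊆ ⋃ L
∈⇒⊆⋃ {L = S ∷ L} (here refl) = p⊆p∪q (⋃ L)
∈⇒⊆⋃ {L = T ∷ L} (there S∈L) = λ x∈S → q⊆p∪q T (⋃ L) (∈⇒⊆⋃ S∈L x∈S)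

⋃-∈ : ∀ {𝒜 : Collection n} → UnionClosed 𝒜 → ∀ {S L} → S ∈ L →
  (∀ {T} → T ∈ L → T ∈ sets 𝒜) → ⋃ L ∈ sets 𝒜
⋃-∈ closed {L = S ∷ []} _ L⊆𝒜 = subst (_∈ _) (sym (∪-identityʳ S)) (L⊆𝒜 (here refl))
⋃-∈ {𝒜 = 𝒜} closed {L = S ∷ T ∷ L} _ L⊆𝒜 =
  closed (L⊆𝒜 (here refl)) (⋃-∈ {𝒜 = 𝒜} closed (here refl) (λ T∈ → L⊆𝒜 (there T∈)))

4*[1+c]≤N+1 : ∀ {N a b c f} → N ≡ a + b → 2 * a < N → 2 * (c + f) < N → b ≤ 2 * f →
  4 * suc c ≤ N + 1
4*[1+c]≤N+1 {N} {a} {b} {c} {f} N≡a+b 2a<N 2[c+f]<N b≤2f = begin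
  4 * suc c                  ≡⟨ 4*suc≡ c ⟩
  suc (2 * suc (2 * c)) + 1  ≤⟨ +-monoˡ-≤ 1 (s≤s (*-monoʳ-≤ 2 2c<a)) ⟩
  suc (2 * a) + 1            ≤⟨ +-monoˡ-≤ 1 2a<N ⟩
  N + 1                      ∎
  where
  open ≤-Reasoning
  4*suc≡ : ∀ k → 4 * suc k ≡ suc (2 * suc (2 * k)) + 1
  4*suc≡ = solve-∀
  2c<a : 2 * c < a
  2c<a = +-cancelʳ-< (2 * f) (2 * c) a (begin-strict
    2 * c + 2 * f  ≡⟨ sym (*-distribˡ-+ 2 c f) ⟩
    2 * (c + f)    <⟨ 2[c+f]<N ⟩
    N              ≡⟨ N≡a+b ⟩
    a + b          ≤⟨ +-monoʳ-≤ a b≤2f ⟩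
    a + 2 * f      ∎)

module Avoiding (𝒜 : Collection n) where

  avoiding : Fin n → List (Subset n)
  avoiding x = filter (∁? (x ∈?_)) (sets 𝒜)

  avoidingCollection : Fin n → Collection n
  avoidingCollection x = mkCollection (avoiding x) (Unique.filter⁺ (∁? (x ∈?_)) (unique 𝒜))

  maxAvoiding : Fin n → Subset n
  maxAvoiding x = ⋃ (avoiding x)

  containingBoth : Fin n → Fin n → List (Subset n)
  containingBoth x y = filter (y ∈?_) (filter (x ∈?_) (sets 𝒜))

  ∈-avoiding⁻ : ∀ {x S} → S ∈ avoiding x → S ∈ sets 𝒜 × x ∉ˢ S
  ∈-avoiding⁻ {x} = ∈-filter⁻ (∁? (x ∈?_)) {xs = sets 𝒜}

  ∈-containingBoth : ∀ {x y S} → S ∈ sets 𝒜 → x ∈ˢ S → y ∈ˢ S → S ∈ containingBoth x y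
  ∈-containingBoth S∈ x∈S y∈S = ∈-filter⁺ _ (∈-filter⁺ _ S∈ x∈S) y∈S

  ∉-maxAvoiding : ∀ x → x ∉ˢ maxAvoiding x
  ∉-maxAvoiding x x∈ with x∈⋃⁻ (avoiding x) x∈
  ... | S , S∈ , x∈S = proj₂ (∈-avoiding⁻ S∈) x∈S

  ⊆-maxAvoiding : ∀ {x S} → S ∈ sets 𝒜 → x ∉ˢ S → S ⊆ maxAvoiding x
  ⊆-maxAvoiding S∈ x∉S = ∈⇒⊆⋃ (∈-filter⁺ _ S∈ x∉S)

  size≡freq+size-avoiding : ∀ x → size 𝒜 ≡ freq 𝒜 x + size (avoidingCollection x)
  size≡freq+size-avoiding x = length-filter-∁ (x ∈?_) (sets 𝒜)

  freq≡both+freq-avoiding : ∀ x y →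
    freq 𝒜 y ≡ length (containingBoth x y) + freq (avoidingCollection x) y
  freq≡both+freq-avoiding x y = length-filter-split (y ∈?_) (x ∈?_) (sets 𝒜)

  ∈U⇒freq>0 : ∀ {x} → x ∈ˢ U 𝒜 → 0 < freq 𝒜 x
  ∈U⇒freq>0 x∈U with x∈⋃⁻ (sets 𝒜) x∈U
  ... | S , S∈ , x∈S = filter-some _ (lose S∈ x∈S)

  size-avoiding< : ∀ {x} → x ∈ˢ U 𝒜 → size (avoidingCollection x) < size 𝒜
  size-avoiding< {x} x∈U = begin-strict
    size (avoidingCollection x)                  <⟨ +-monoˡ-≤ _ (∈U⇒freq>0 x∈U) ⟩
    freq 𝒜 x + size (avoidingCollection x)      ≡⟨ sym (size≡freq+size-avoiding x) ⟩
    size 𝒜                                       ∎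
    where open ≤-Reasoning

  avoiding-unionClosed : UnionClosed 𝒜 → ∀ x → UnionClosed (avoidingCollection x)
  avoiding-unionClosed closed x {S} {T} S∈ T∈ with ∈-avoiding⁻ S∈ | ∈-avoiding⁻ T∈
  ... | S∈𝒜 , x∉S | T∈𝒜 , x∉T = ∈-filter⁺ _ (closed S∈𝒜 T∈𝒜) ([ x∉S , x∉T ]′ ∘ x∈p∪q⁻ S T)

  U-avoiding⊆U : ∀ x → U (avoidingCollection x) ⊆ U 𝒜
  U-avoiding⊆U x y∈ with x∈⋃⁻ (avoiding x) y∈
  ... | S , S∈ , y∈S = ∈⇒⊆⋃ (proj₁ (∈-avoiding⁻ S∈)) y∈S

  freq-avoiding-mono : ∀ x {y z} → y ∉ˢ maxAvoiding z →
    freq (avoidingCollection x) y ≤ freq (avoidingCollection x) z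
  freq-avoiding-mono x {y} {z} y∉Mz = length-filter-mono (y ∈?_) (z ∈?_) (avoiding x) λ S∈ y∈S →
    decidable-stable (z ∈? _) λ z∉S → y∉Mz (⊆-maxAvoiding (proj₁ (∈-avoiding⁻ S∈)) z∉S y∈S)

module SeparatingCounterexample
  (𝒜 : Collection n) (separating : Separating 𝒜) (closed : UnionClosed 𝒜)
  (rare : ∀ x → x ∈ˢ U 𝒜 → 2 * freq 𝒜 x < size 𝒜) where

  open Avoiding 𝒜

  avoiding-hasNonempty : ∀ {x} → x ∈ˢ U 𝒜 → HasNonemptySet (avoidingCollection x)
  avoiding-hasNonempty {x} x∈U with Any.any? nonempty? (avoiding x)
  ... | yes ∃nonempty = find ∃nonempty
  ... | no ∄nonempty = contradiction (rare x x∈U) (≤⇒≯ (begin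
    size 𝒜                                   ≡⟨ size≡freq+size-avoiding x ⟩
    freq 𝒜 x + size (avoidingCollection x)  ≤⟨ +-monoʳ-≤ (freq 𝒜 x) size≤1 ⟩
    freq 𝒜 x + 1                             ≤⟨ +-monoʳ-≤ (freq 𝒜 x) 1≤freq+0 ⟩
    2 * freq 𝒜 x                             ∎))
    where
    open ≤-Reasoning
    1≤freq+0 : 1 ≤ freq 𝒜 x + 0
    1≤freq+0 = ≤-trans (∈U⇒freq>0 x∈U) (m≤m+n _ 0)
    -- All members avoiding x are empty, hence equal, so there is at most one of them.
    size≤1 : size (avoidingCollection x) ≤ 1
    size≤1 = length-≤-injection {ys = [ ⊥ ]} (unique (avoidingCollection x)) (λ _ _ → id)
      λ S∈ → here (Empty-unique λ nonempty → ∄nonempty (lose S∈ nonempty))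

  maxAvoiding∈sets : ∀ {x} → x ∈ˢ U 𝒜 → maxAvoiding x ∈ sets 𝒜
  maxAvoiding∈sets x∈U with avoiding-hasNonempty x∈U
  ... | _ , S∈ , _ = ⋃-∈ {𝒜 = 𝒜} closed S∈ (proj₁ ∘ ∈-avoiding⁻)

  U∈sets : ∀ {x} → x ∈ˢ U 𝒜 → U 𝒜 ∈ sets 𝒜
  U∈sets x∈U with x∈⋃⁻ (sets 𝒜) x∈U
  ... | _ , S∈ , _ = ⋃-∈ {𝒜 = 𝒜} closed S∈ id

  maxAvoiding-tournament : ∀ {x y} → x ∈ˢ U 𝒜 → y ∈ˢ U 𝒜 → x ≢ y →
    y ∈ˢ maxAvoiding x ⊎ x ∈ˢ maxAvoiding y
  maxAvoiding-tournament x∈U y∈U x≢y with separating _ _ x∈U y∈U x≢y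
  ... | S , S∈ , inj₁ (x∈S , y∉S) = inj₂ (⊆-maxAvoiding S∈ y∉S x∈S)
  ... | S , S∈ , inj₂ (y∈S , x∉S) = inj₁ (⊆-maxAvoiding S∈ x∉S y∈S)

  maxAvoiding-injective : ∀ {x y} → x ∈ˢ U 𝒜 → y ∈ˢ U 𝒜 → maxAvoiding x ≡ maxAvoiding y → x ≡ y
  maxAvoiding-injective {x} {y} x∈U y∈U Mx≡My with x ≟ y
  ... | yes x≡y = x≡y
  ... | no x≢y with maxAvoiding-tournament x∈U y∈U x≢y
  ...   | inj₁ y∈Mx = contradiction (subst (y ∈ˢ_) Mx≡My y∈Mx) (∉-maxAvoiding y)
  ...   | inj₂ x∈My = contradiction (subst (x ∈ˢ_) (sym Mx≡My) x∈My) (∉-maxAvoiding x)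

  maxAvoiding-⊂ : ∀ {x z} → x ∈ˢ U 𝒜 → z ∈ˢ U 𝒜 → z ≢ x → x ∉ˢ maxAvoiding z →
    maxAvoiding z ⊂ maxAvoiding x
  maxAvoiding-⊂ x∈U z∈U z≢x x∉Mz with maxAvoiding-tournament z∈U x∈U z≢x
  ... | inj₁ x∈Mz = contradiction x∈Mz x∉Mz
  ... | inj₂ z∈Mx = ⊆-maxAvoiding (maxAvoiding∈sets z∈U) x∉Mz , _ , z∈Mx , ∉-maxAvoiding _

  Dominating : Fin n → Set
  Dominating x = ∀ z → z ∈ˢ U 𝒜 → z ≢ x → x ∈ˢ maxAvoiding z

  dominating-if-minimal : ∀ {x} → x ∈ˢ U 𝒜 →
    (∀ z → z ∈ˢ U 𝒜 → x ∉ˢ maxAvoiding z → ∣ maxAvoiding x ∣ ≤ ∣ maxAvoiding z ∣) → Dominating x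
  dominating-if-minimal {x} x∈U minimal z z∈U z≢x with x ∈? maxAvoiding z
  ... | yes x∈Mz = x∈Mz
  ... | no x∉Mz = contradiction (minimal z z∈U x∉Mz)
    (<⇒≱ (p⊂q⇒∣p∣<∣q∣ (maxAvoiding-⊂ x∈U z∈U z≢x x∉Mz)))

  ∃-dominating : HasNonemptySet 𝒜 → ∃ λ x → x ∈ˢ U 𝒜 × Dominating x
  ∃-dominating (S , S∈ , w , w∈S) with ∃-minimal (_∈? U 𝒜) (∣_∣ ∘ maxAvoiding) (∈⇒⊆⋃ S∈ w∈S)
  ... | x , x∈U , minimal = x , x∈U , dominating-if-minimal x∈U λ z z∈U _ → minimal z z∈U

  ∃-abundant-dominating : ∀ {x} → (let ℬ = avoidingCollection x) →
    (∃ λ y → y ∈ˢ U ℬ × 2 * freq ℬ y ≥ size ℬ) →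
    ∃ λ y → y ∈ˢ U 𝒜 × 2 * freq ℬ y ≥ size ℬ × Dominating y
  ∃-abundant-dominating {x} (y₀ , y₀∈Uℬ , y₀-abundant)
    with ∃-minimal (λ z → z ∈? U 𝒜 ×-dec size ℬ ≤? 2 * freq ℬ z) (∣_∣ ∘ maxAvoiding)
                   (U-avoiding⊆U x y₀∈Uℬ , y₀-abundant)
    where ℬ = avoidingCollection x
  ... | y , (y∈U , y-abundant) , minimal =
    y , y∈U , y-abundant , dominating-if-minimal y∈U λ z z∈U y∉Mz →
      minimal z (z∈U , ≤-trans y-abundant (*-monoʳ-≤ 2 (freq-avoiding-mono x y∉Mz)))

  ∣U∣≤suc-containingBoth : ∀ {x y} → x ∈ˢ U 𝒜 → y ∈ˢ U 𝒜 → Dominating x → Dominating y →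
    ∣ U 𝒜 ∣ ≤ suc (length (containingBoth x y))
  ∣U∣≤suc-containingBoth {x} {y} x∈U y∈U x-dominating y-dominating = begin
    ∣ U 𝒜 ∣                                      ≡⟨ sym (length-elements (U 𝒜)) ⟩
    length (elements (U 𝒜))                      ≤⟨ length-≤-injection (elements-Unique (U 𝒜))
                                                      (λ u∈ v∈ → member-injective (∈U u∈) (∈U v∈))
                                                      (member-∈ ∘ ∈U) ⟩
    length (maxAvoiding y ∷ containingBoth x y)  ∎
    where
    open ≤-Reasoning
    ∈U : ∀ {z} → z ∈ elements (U 𝒜) → z ∈ˢ U 𝒜
    ∈U = ∈-elements⁻ (U 𝒜)

    -- Only maxAvoiding y may fail to contain both x and y.
    member : Fin n → Subset n
    member z with z ≟ x
    ... | yes _ = U 𝒜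
    ... | no _  = maxAvoiding z

    member-∈ : ∀ {z} → z ∈ˢ U 𝒜 → member z ∈ maxAvoiding y ∷ containingBoth x y
    member-∈ {z} z∈U with z ≟ x
    ... | yes _ = there (∈-containingBoth (U∈sets x∈U) x∈U y∈U)
    ... | no z≢x with z ≟ y
    ...   | yes refl = here refl
    ...   | no z≢y = there (∈-containingBoth (maxAvoiding∈sets z∈U)
                                (x-dominating z z∈U z≢x) (y-dominating z z∈U z≢y))

    member-injective : ∀ {u v} → u ∈ˢ U 𝒜 → v ∈ˢ U 𝒜 → member u ≡ member v → u ≡ v
    member-injective {u} {v} u∈U v∈U mu≡mv with u ≟ x | v ≟ x
    ... | yes u≡x | yes v≡x = trans u≡x (sym v≡x)
    ... | yes _   | no _    = contradiction (subst (v ∈ˢ_) mu≡mv v∈U) (∉-maxAvoiding v)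
    ... | no _    | yes _   = contradiction (subst (u ∈ˢ_) (sym mu≡mv) u∈U) (∉-maxAvoiding u)
    ... | no _    | no _    = maxAvoiding-injective u∈U v∈U mu≡mv

theorem1 : ∀ n (𝒜 : Collection n) → Separating 𝒜 → MinimalCounterexample 𝒜 →
    size 𝒜 + 1 ≥ 4 * ∣ U 𝒜 ∣
theorem1 n 𝒜 separating ((closed , hasNonempty , rare) , minimal) =
  let x , x∈U , x-dominating = ∃-dominating hasNonempty
      ℬ = avoidingCollection x
      y , y∈U , y-abundant , y-dominating = ∃-abundant-dominating
        (minimal n ℬ (size-avoiding< x∈U) (avoiding-unionClosed closed x)
                 (avoiding-hasNonempty x∈U))
      c = length (containingBoth x y)
      y-rare : 2 * (c + freq ℬ y) < size 𝒜
      y-rare = subst (λ k → 2 * k < size 𝒜) (freq≡both+freq-avoiding x y) (rare y y∈U)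
  in begin
    4 * ∣ U 𝒜 ∣  ≤⟨ *-monoʳ-≤ 4 (∣U∣≤suc-containingBoth x∈U y∈U x-dominating y-dominating) ⟩
    4 * suc c    ≤⟨ 4*[1+c]≤N+1 (size≡freq+size-avoiding x) (rare x x∈U) y-rare y-abundant ⟩
    size 𝒜 + 1   ∎
  where
  open ≤-Reasoning
  open Avoiding 𝒜
  open SeparatingCounterexample 𝒜 separating closed rare
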